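{- Let $b\geq 1$ and $\tau\in\{\tau^b_0,\tau^b_1\}$. Let $\varphi=\{C_0,\dots,C_{m-1}\}$ be an instance of cubic monotone one-in-three 3-SAT with $C_i=\{X_{i,0},X_{i,1},X_{i,2}\}$, and let $T$ be the union of the transition systems $T_{i,0},T_{i,1},T_{i,2}$, $0\leq i\leq m-1$, defined in the context. (1) If $(sup_T,sig_T)$ is a $\tau$-region of $T$ such that $sig_T(k_0)=\dots=sig_T(k_{6m-1})=(0,b)$ or $sig_T(k_0)=\dots=sig_T(k_{6m-1})=(b,0)$, then $\varphi$ has a one-in-three model. (2) If $\varphi$ has a one-in-three model, then there is a $\tau$-region $(sup_T,sig_T)$ of $T$ such that $sig_T(k_0)=\dots=sig_T(k_{6m-1})=(0,b)$.
   Context: Types: $\tau^b_0=(\{0,\dots,b\},\{0,\dots,b\}^2,\delta)$ with $\delta(s,(m,n))=s-m+n$ if $s\geq m$ and $s-m+n\leq b$, undefined otherwise; $\tau^b_1$ is $\tau^b_0$ with the events $\{(m,n)\mid 1\leq m,n\leq b\}$ removed. A transition system (TS) has finite sets of states and events and a partial transition function; a $\tau$-region of a TS $A$ is $(sup,sig)$, $sup:S_A\to S_\tau$, $sig:E_A\to E_\tau$, such that every transition $s\xrightarrow{e}s'$ of $A$ yields a transition $sup(s)\xrightarrow{sig(e)}sup(s')$ of $\tau$. For a union $U$ of TSs with pairwise disjoint state sets (events may be shared), a $\tau$-region of $U$ is a pair of maps on all states and all events of $U$ whose restriction to each constituent TS is a $\tau$-region of it. Cubic monotone one-in-three 3-SAT: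 an instance is $\varphi=\{C_0,\dots,C_{m-1}\}$ where each clause $C_i=\{X_{i,0},X_{i,1},X_{i,2}\}$ is a set of three unnegated boolean variables and every variable occurs in exactly three clauses (so the set of variables is $V(\varphi)=\{X_0,\dots,X_{m-1}\}$). A one-in-three model is $M\subseteq V(\varphi)$ with $|M\cap C_i|=1$ for all $i$. Translator $T$: for each $i\in\{0,\dots,m-1\}$ (writing $s\xrightarrow{e}^{b}s'$ for $b$ consecutive $e$-labelled transitions through fresh intermediate states), the linear TSs $T_{i,0}$: $t_{i,0,0}\xrightarrow{k_{6i}}t_{i,0,1}\xrightarrow{X_{i,0}}t_{i,0,2}\cdots\xrightarrow{X_{i,0}}t_{i,0,b+1}\xrightarrow{x_i}t_{i,0,b+2}\xrightarrow{X_{i,2}}\cdots\xrightarrow{X_{i,2}}t_{i,0,2b+2}\xrightarrow{k_{6i+1}}t_{i,0,2b+3}$ (so $X_{i,0}$ and $X_{i,2}$ each occur $b$ times in a row); $T_{i,1}$: $t_{i,1,0}\xrightarrow{k_{6i+2}}t_{i,1,1}\xrightarrow{X_{i,1}}\cdots\xrightarrow{X_{i,1}}t_{i,1,b+1}\xrightarrow{p_i}t_{i,1,b+2}\xrightarrow{k_{6i+3}}t_{i,1,b+3}$ ($X_{i,1}$ occurring $b$ times in a row); $T_{i,2}$: $t_{i,2,0}\xrightarrow{k_{6i+4}}t_{i,2,1}\xrightarrow{x_i}t_{i,2,2}\xrightarrow{p_i}t_{i,2,3}\xrightarrow{k_{6i+5}}t_{i,2,4}$; all with pairwise distinct states, initial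 states $t_{i,0,0},t_{i,1,0},t_{i,2,0}$; the variables are used as event names (so a variable occurring in several clauses is one shared event), and $k_0,\dots,k_{6m-1}$, $x_i$, $p_i$ are further events. $T=U(T_{0,0},T_{0,1},T_{0,2},\dots,T_{m-1,0},T_{m-1,1},T_{m-1,2})$. -}

module Defs where

open import Data.Nat using (ℕ; zero; suc; _+_; _*_; _∸_; _≤_; _≟_)
open import Data.Bool using (Bool; true; false)
open import Data.Fin using (Fin; inject₁) renaming (suc to fsuc; zero to fzero)
import Data.Fin.Properties as FinP
open import Data.List using (List; []; _∷_; _++_; replicate; length; lookup; filter)
open import Data.List.Base using (allFin)
open import Data.Product using (Σ; _×_; _,_; ∃; proj₁; proj₂)
open import Data.Sum using (_⊎_)
open import Relation.Binary.PropositionalEquality using (_≡_)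
import Data.Bool.Properties as BoolP

-- States of τ^b_i are {0,…,b} (naturals ≤ b); events are pairs (m,n)
-- with m,n ≤ b; for τ^b_1 the events with 1 ≤ m and 1 ≤ n are removed,
-- i.e. m ≡ 0 or n ≡ 0.

data Kind : Set where
  τ0 τ1 : Kind

StateOf : (b : ℕ) → ℕ → Set
StateOf b s = s ≤ b

EventOf : Kind → (b : ℕ) → ℕ × ℕ → Set
EventOf τ0 b (m , n) = (m ≤ b) × (n ≤ b)
EventOf τ1 b (m , n) = (m ≤ b) × (n ≤ b) × (m ≡ 0 ⊎ n ≡ 0)

TypeStep : (b : ℕ) → ℕ → ℕ × ℕ → ℕ → Set
TypeStep b s (m , n) s' = (m ≤ s) × (s ∸ m + n ≤ b) × (s' ≡ s ∸ m + n)

-- Transition systems over a (shared) event type E; the partial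
-- transition function is given as its graph.

record TS (E : Set) : Set₁ where
  field
    State : Set
    Trans : State → E → State → Set
open TS public

IsRegion : Kind → (b : ℕ) → {E : Set} → (A : TS E) →
           (State A → ℕ) → (E → ℕ × ℕ) → Set
IsRegion t b A sup sig =
  (∀ s → StateOf b (sup s)) ×
  (∀ e → EventOf t b (sig e)) ×
  (∀ s e s' → Trans A s e s' → TypeStep b (sup s) (sig e) (sup s'))

data LinStep {E : Set} (w : List E) :
     Fin (suc (length w)) → E → Fin (suc (length w)) → Set where
  step : (j : Fin (length w)) → LinStep w (inject₁ j) (lookup w j) (fsuc j)

Linear : {E : Set} → List E → TS E
Linear w = record { State = Fin (suc (length w)) ; Trans = LinStep w }

-- Cubic monotone one-in-three 3-SAT.
-- Variables X_0,…,X_{m-1} are Fin m; clause i is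
-- {clause i 0, clause i 1, clause i 2}.

record Instance (m : ℕ) : Set where
  field
    clause   : Fin m → Fin 3 → Fin m
    distinct : ∀ i j j' → clause i j ≡ clause i j' → j ≡ j'
    -- φ is a set of clauses: C_i ⊆ C_i' implies i ≡ i'
    clausesDistinct : ∀ i i' →
      (∀ v → (∃ λ j → clause i j ≡ v) → (∃ λ j → clause i' j ≡ v)) → i ≡ i'
    cubic : ∀ v →
      length (filter (λ i → FinP.any? (λ j → clause i j FinP.≟ v)) (allFin m)) ≡ 3
open Instance public

IsModel : {m : ℕ} → Instance m → (Fin m → Bool) → Set
IsModel {m} φ M = ∀ i →
  length (filter (λ j → M (clause φ i j) BoolP.≟ true) (allFin 3)) ≡ 1

HasModel : {m : ℕ} → Instance m → Set
HasModel φ = ∃ λ M → IsModel φ M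

-- The translator T.
-- Events: variables X_v, the k-events (k i r stands for k_{6i+r},
-- r ∈ {0,…,5}), and x_i, p_i.

data Ev (m : ℕ) : Set where
  var : Fin m → Ev m
  k   : Fin m → Fin 6 → Ev m
  x   : Fin m → Ev m
  p   : Fin m → Ev m

private
  f0 f1 f2 : {n : ℕ} → Fin (3 + n)
  f0 = fzero
  f1 = fsuc fzero
  f2 = fsuc (fsuc fzero)
  f3 f4 f5 : {n : ℕ} → Fin (6 + n)
  f3 = fsuc (fsuc (fsuc fzero))
  f4 = fsuc (fsuc (fsuc (fsuc fzero)))
  f5 = fsuc (fsuc (fsuc (fsuc (fsuc fzero))))

word : (b : ℕ) → {m : ℕ} → Instance m → Fin m → Fin 3 → List (Ev m)
word b φ i fzero =
  k i f0 ∷ replicate b (var (clause φ i f0)) ++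
  x i ∷ replicate b (var (clause φ i f2)) ++ k i f1 ∷ []
word b φ i (fsuc fzero) =
  k i f2 ∷ replicate b (var (clause φ i f1)) ++ p i ∷ k i f3 ∷ []
word b φ i (fsuc (fsuc fzero)) =
  k i f4 ∷ x i ∷ p i ∷ k i f5 ∷ []

Tcomp : (b : ℕ) → {m : ℕ} → Instance m → Fin m → Fin 3 → TS (Ev m)
Tcomp b φ i c = Linear (word b φ i c)

-- (sup , sig) is a τ-region of the union T of all T_{i,c}:
-- sup is defined on the (disjoint) states of every constituent, sig on
-- the shared events, and each restriction is a τ-region.
IsRegionT : Kind → (b : ℕ) → {m : ℕ} → (φ : Instance m) →
            ((i : Fin m) (c : Fin 3) → State (Tcomp b φ i c) → ℕ) →
            (Ev m → ℕ × ℕ) → Set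
IsRegionT t b φ sup sig = ∀ i c → IsRegion t b (Tcomp b φ i c) (sup i c) sig

AllK : {m : ℕ} → (Ev m → ℕ × ℕ) → ℕ × ℕ → Set
AllK sig ev = ∀ i r → sig (k i r) ≡ ev

module Submission where

-- Every step s --(m,n)--> s' of τ conserves  s' + m ≡ s + n,
-- so a run of b equal X-steps relates its end points by  B + b·m ≡ S + b·n.
-- As both end points lie in {0,…,b}, either X is balanced (m ≡ n) and the
-- run returns to its start, or it is not and the run jumps between the
-- two extremes ("digit lemma").  If all k-events carry (0,b) (resp.
-- (b,0)), every component of T starts right after a k-step in the "entry"
-- state b (resp. 0) and ends right before one in the "exit" state 0
-- (resp. b).  Chasing the three components of clause i then forces
-- exactly one of X_{i,0}, X_{i,1}, X_{i,2} to be unbalanced, so the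
-- unbalanced variables form a one-in-three model (part 1).  Conversely a
-- model M yields an explicit region: X_v consumes 1 iff v ∈ M, and x_i,
-- p_i empty the state (consume b) depending on whether X_{i,1} ∈ M (part 2).

open import Defs
open import Data.Nat using (ℕ; zero; suc; _+_; _*_; _∸_; _≤_; _<_; z≤n; s≤s; _≡ᵇ_)
open import Data.Nat.Properties
open import Algebra.Properties.CommutativeSemigroup +-commutativeSemigroup
  using (interchange; x∙yz≈xz∙y; xy∙z≈xz∙y)
open import Data.Bool using (Bool; true; false; not; if_then_else_; T)
open import Data.Unit using (tt)
import Data.Bool.Properties as BoolP
open import Data.Fin using (Fin; fromℕ) renaming (zero to fzero; suc to fsuc)
open import Data.List using (List; []; _∷_; _++_; replicate; length; filter)
open import Data.List.Base using (allFin)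
open import Data.List.Properties using (filter-≐)
open import Data.Vec using (lookup) renaming ([] to []ᵛ; _∷_ to _∷ᵛ_)
open import Data.Product using (Σ; _×_; _,_; proj₁; proj₂)
open import Data.Sum using (_⊎_; inj₁; inj₂)
open import Data.Empty using (⊥-elim)
open import Relation.Binary.Definitions using (tri<; tri≈; tri>)
open import Relation.Binary.PropositionalEquality

j₀ j₁ j₂ : Fin 3
j₀ = fzero
j₁ = fsuc fzero
j₂ = fsuc (fsuc fzero)

step-conserves : ∀ {b s ev s'} → TypeStep b s ev s' → s' + proj₁ ev ≡ s + proj₂ ev
step-conserves {s = s} {m , n} (m≤s , _ , refl) = begin
  s ∸ m + n + m    ≡⟨ xy∙z≈xz∙y (s ∸ m) n m ⟩
  s ∸ m + m + n    ≡⟨ cong (_+ n) (m∸n+n≡m m≤s) ⟩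
  s + n            ∎
  where open ≡-Reasoning

step-bounded : ∀ {b s ev s'} → TypeStep b s ev s' → s' ≤ b
step-bounded {ev = _ , _} (_ , s'≤b , refl) = s'≤b

consuming-step : ∀ {b a s} → a ≤ s → s ≤ b → TypeStep b s (a , 0) (s ∸ a)
consuming-step {b} {a} {s} a≤s s≤b =
  a≤s , ≤-trans (≤-reflexive (+-identityʳ (s ∸ a))) (≤-trans (m∸n≤m s a) s≤b) ,
  sym (+-identityʳ (s ∸ a))

emptying-step : ∀ {b a} → a ≤ b → TypeStep b a (a , 0) 0
emptying-step {b} {a} a≤b =
  subst (λ s' → TypeStep b a (a , 0) s') (n∸n≡0 a) (consuming-step ≤-refl a≤b)

filling-step : ∀ {b} → TypeStep b 0 (0 , b) b
filling-step = z≤n , ≤-refl , refl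

conserve-trans : ∀ {s s₁ s₂ a c a' c'} →
  s₁ + a ≡ s + c → s₂ + a' ≡ s₁ + c' → s₂ + (a + a') ≡ s + (c + c')
conserve-trans {s} {s₁} {s₂} {a} {c} {a'} {c'} h₁ h₂ = begin
  s₂ + (a + a')    ≡⟨ x∙yz≈xz∙y s₂ a a' ⟩
  s₂ + a' + a      ≡⟨ cong (_+ a) h₂ ⟩
  s₁ + c' + a      ≡⟨ xy∙z≈xz∙y s₁ c' a ⟩
  s₁ + a + c'      ≡⟨ cong (_+ c') h₁ ⟩
  s + c + c'       ≡⟨ +-assoc s c c' ⟩
  s + (c + c')     ∎
  where open ≡-Reasoning

conserve-difference : ∀ {a c d e u v} →
  a + u ≡ c + v → d + u ≡ e + v → a + e ≡ c + d
conserve-difference {a} {c} {d} {e} {u} {v} h₁ h₂ = +-cancelʳ-≡ (u + v) (a + e) (c + d) (begin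
  a + e + (u + v)     ≡⟨ interchange a e u v ⟩
  a + u + (e + v)     ≡⟨ cong₂ _+_ h₁ (sym h₂) ⟩
  c + v + (d + u)     ≡⟨ interchange c v d u ⟩
  c + d + (v + u)     ≡⟨ cong (c + d +_) (+-comm v u) ⟩
  c + d + (u + v)     ∎)
  where open ≡-Reasoning

-- The digit lemma: states X, Y ∈ {0,…,b} with  X + b·m ≡ Y + b·n.

digit-balanced : ∀ {b X Y m n} → X + b * m ≡ Y + b * n → m ≡ n → X ≡ Y
digit-balanced {b} {X} {Y} {m} eq refl = +-cancelʳ-≡ (b * m) X Y eq

digit-excess : ∀ {b X Y m n} → m < n → X + b * m ≡ Y + b * n → Y + b ≤ X
digit-excess {b} {X} {Y} {m} {n} m<n eq = +-cancelʳ-≤ (b * m) (Y + b) X (begin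
  Y + b + b * m     ≡⟨ +-assoc Y b (b * m) ⟩
  Y + (b + b * m)   ≡⟨ cong (Y +_) (sym (*-suc b m)) ⟩
  Y + b * suc m     ≤⟨ +-monoʳ-≤ Y (*-monoʳ-≤ b m<n) ⟩
  Y + b * n         ≡⟨ sym eq ⟩
  X + b * m         ∎)
  where open ≤-Reasoning

extremes : ∀ {b X Y} → X ≤ b → Y + b ≤ X → X + Y ≡ b
extremes {b} {X} {Y} X≤b Y+b≤X = begin
  X + Y   ≡⟨ cong (X +_) Y≡0 ⟩
  X + 0   ≡⟨ +-identityʳ X ⟩
  X       ≡⟨ ≤-antisym X≤b (m+n≤o⇒n≤o Y Y+b≤X) ⟩
  b       ∎
  where
  open ≡-Reasoning
  Y≡0 : Y ≡ 0
  Y≡0 = n≤0⇒n≡0 (+-cancelʳ-≤ b Y 0 (≤-trans Y+b≤X X≤b))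

digit-unbalanced : ∀ {b X Y m n} → X ≤ b → Y ≤ b →
  X + b * m ≡ Y + b * n → m ≢ n → X + Y ≡ b
digit-unbalanced {b} {X} {Y} {m} {n} X≤b Y≤b eq m≢n with <-cmp m n
... | tri< m<n _ _ = extremes X≤b (digit-excess {b} m<n eq)
... | tri≈ _ m≡n _ = ⊥-elim (m≢n m≡n)
... | tri> _ _ n<m = trans (+-comm X Y) (extremes Y≤b (digit-excess {b} n<m (sym eq)))

record Border (b : ℕ) (K : ℕ × ℕ) : Set where
  field
    entry exit    : ℕ
    complementary : entry + exit ≡ b
    entry≢exit    : entry ≢ exit
    leaves        : ∀ {s s'} → s ≤ b → TypeStep b s K s' → s ≡ exit
    enters        : ∀ {s s'} → s ≤ b → TypeStep b s K s' → s' ≡ entry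

-- (0,b) can only fill the empty state.
filling-border : ∀ {b} → 1 ≤ b → Border b (0 , b)
filling-border {b} 1≤b = record
  { entry = b ; exit = 0 ; complementary = +-identityʳ b
  ; entry≢exit = λ b≡0 → <⇒≢ 1≤b (sym b≡0)
  ; leaves = empty ; enters = λ s≤b st → trans (proj₂ (proj₂ st)) (cong (_+ b) (empty s≤b st)) }
  where
  empty : ∀ {s s'} → s ≤ b → TypeStep b s (0 , b) s' → s ≡ 0
  empty {s} _ (_ , s+b≤b , _) = n≤0⇒n≡0 (+-cancelʳ-≤ b s 0 s+b≤b)

-- (b,0) can only empty the full state.
draining-border : ∀ {b} → 1 ≤ b → Border b (b , 0)
draining-border {b} 1≤b = record
  { entry = 0 ; exit = b ; complementary = refl
  ; entry≢exit = λ 0≡b → <⇒≢ 1≤b 0≡b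
  ; leaves = λ s≤b (b≤s , _) → ≤-antisym s≤b b≤s
  ; enters = λ {s} s≤b (b≤s , _ , s'≡) →
      trans s'≡ (trans (+-identityʳ (s ∸ b)) (m≤n⇒m∸n≡0 s≤b)) }

-- Walks: runs of τ along a word, under a fixed signature.  They are the
-- same thing as regions of the linear transition system of that word.

module Walks {Ev : Set} (b : ℕ) (sig : Ev → ℕ × ℕ) where

  data Walk : ℕ → List Ev → ℕ → Set where
    []  : ∀ {s} → Walk s [] s
    _∷_ : ∀ {s e s₁ w s'} → TypeStep b s (sig e) s₁ → Walk s₁ w s' → Walk s (e ∷ w) s'

  balanced : Ev → Bool
  balanced e = proj₁ (sig e) ≡ᵇ proj₂ (sig e)

  balanced-true : ∀ {e} → balanced e ≡ true → proj₁ (sig e) ≡ proj₂ (sig e)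
  balanced-true eq = ≡ᵇ⇒≡ _ _ (subst T (sym eq) tt)

  balanced-false : ∀ {e} → balanced e ≡ false → proj₁ (sig e) ≢ proj₂ (sig e)
  balanced-false eq m≡n = subst T eq (≡⇒≡ᵇ _ _ m≡n)

  walk-++ : ∀ {s s₁ s' u v} → Walk s u s₁ → Walk s₁ v s' → Walk s (u ++ v) s'
  walk-++ []       W' = W'
  walk-++ (st ∷ W) W' = st ∷ walk-++ W W'

  walk-split : ∀ {s s' v} u → Walk s (u ++ v) s' → Σ ℕ λ s₁ → Walk s u s₁ × Walk s₁ v s'
  walk-split []      W        = _ , [] , W
  walk-split (e ∷ u) (st ∷ W) with walk-split u W
  ... | s₁ , W₁ , W₂ = s₁ , st ∷ W₁ , W₂

  walk-bounded : ∀ {s w s'} → s ≤ b → Walk s w s' → s' ≤ b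
  walk-bounded s≤b []       = s≤b
  walk-bounded _   (st ∷ W) = walk-bounded (step-bounded st) W

  walk-repeat : ∀ {s s' e} n → Walk s (replicate n e) s' →
    s' + n * proj₁ (sig e) ≡ s + n * proj₂ (sig e)
  walk-repeat zero    []       = refl
  walk-repeat {s} {s'} (suc n) (_∷_ {s₁ = s₁} st W) =
    conserve-trans {s} {s₁} {s'} (step-conserves st) (walk-repeat n W)

  countdown : ∀ {e} n → sig e ≡ (1 , 0) → n ≤ b → Walk n (replicate n e) 0
  countdown zero    _  _   = []
  countdown (suc n) eq n≤b =
    subst (λ ev → TypeStep b (suc n) ev n) (sym eq) (consuming-step (s≤s z≤n) n≤b) ∷
    countdown n eq (≤-trans (n≤1+n n) n≤b)

  idle : ∀ {e s} n → sig e ≡ (0 , 0) → s ≤ b → Walk s (replicate n e) s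
  idle zero    _  _   = []
  idle (suc n) eq s≤b =
    subst (λ ev → TypeStep b _ ev _) (sym eq) (consuming-step z≤n s≤b) ∷ idle n eq s≤b

  Steps : (w : List Ev) → (Fin (suc (length w)) → ℕ) → Set
  Steps w sup = ∀ s e s' → LinStep w s e s' → TypeStep b (sup s) (sig e) (sup s')

  steps→walk : ∀ w sup → Steps w sup → Walk (sup fzero) w (sup (fromℕ (length w)))
  steps→walk []      sup _     = []
  steps→walk (e ∷ w) sup steps =
    steps _ _ _ (step fzero) ∷
    steps→walk w (λ j → sup (fsuc j)) (λ { _ _ _ (step j) → steps _ _ _ (step (fsuc j)) })

  walk-states : ∀ {s w s'} → Walk s w s' → Fin (suc (length w)) → ℕ
  walk-states {s} _        fzero    = s
  walk-states     (_ ∷ W)  (fsuc j) = walk-states W j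

  walk-steps : ∀ {s w s'} (W : Walk s w s') → Steps w (walk-states W)
  walk-steps (st ∷ W) _ _ _ (step fzero)    = st
  walk-steps (st ∷ W) _ _ _ (step (fsuc j)) = walk-steps W _ _ _ (step j)

  states-bounded : ∀ {s w s'} → s ≤ b → (W : Walk s w s') → ∀ j → walk-states W j ≤ b
  states-bounded s≤b _        fzero    = s≤b
  states-bounded _   (st ∷ W) (fsuc j) = states-bounded (step-bounded st) W j

data ExactlyOne : Bool → Bool → Bool → Set where
  first  : ExactlyOne true false false
  second : ExactlyOne false true false
  third  : ExactlyOne false false true

count : (Fin 3 → Bool) → ℕ
count g = length (filter (λ j → g j BoolP.≟ true) (allFin 3))

values : (Fin 3 → Bool) → Fin 3 → Bool
values g = lookup (g j₀ ∷ᵛ g j₁ ∷ᵛ g j₂ ∷ᵛ []ᵛ)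

count-values : ∀ g → count g ≡ count (values g)
count-values g = cong length
  (filter-≐ (λ j → g j BoolP.≟ true) (λ j → values g j BoolP.≟ true)
            ((λ {j} → trans (sym (agree j))) , (λ {j} → trans (agree j))) (allFin 3))
  where
  agree : ∀ j → g j ≡ values g j
  agree fzero               = refl
  agree (fsuc fzero)        = refl
  agree (fsuc (fsuc fzero)) = refl

count-one : ∀ a c d → count (lookup (a ∷ᵛ c ∷ᵛ d ∷ᵛ []ᵛ)) ≡ 1 → ExactlyOne a c d
count-one true  false false _ = first
count-one false true  false _ = second
count-one false false true  _ = third
count-one true  true  _     ()
count-one true  false true  ()
count-one false true  true  ()
count-one false false false ()

one-count : ∀ {a c d} → ExactlyOne a c d → count (lookup (a ∷ᵛ c ∷ᵛ d ∷ᵛ []ᵛ)) ≡ 1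
one-count first  = refl
one-count second = refl
one-count third  = refl

count⇒exactly-one : ∀ g → count g ≡ 1 → ExactlyOne (g j₀) (g j₁) (g j₂)
count⇒exactly-one g h = count-one (g j₀) (g j₁) (g j₂) (trans (sym (count-values g)) h)

exactly-one⇒count : ∀ g → ExactlyOne (g j₀) (g j₁) (g j₂) → count g ≡ 1
exactly-one⇒count g one = trans (count-values g) (one-count one)

-- The combinatorial core of part 1: the three levels B, B', C of a clause
-- (each determined by whether X_{i,j} is balanced) satisfy C + S ≡ B + B'
-- only if exactly one X_{i,j} is unbalanced.
levels-exactly-one : ∀ {S E B B' C} β₀ β₁ β₂ → S ≢ E →
  B ≡ (if β₀ then S else E) → B' ≡ (if β₁ then S else E) → C ≡ (if β₂ then E else S) →
  C + S ≡ B + B' → ExactlyOne (not β₀) (not β₁) (not β₂)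
levels-exactly-one false true  true  _   refl refl refl _ = first
levels-exactly-one true  false true  _   refl refl refl _ = second
levels-exactly-one true  true  false _   refl refl refl _ = third
levels-exactly-one {S} {E} true  true  true  S≢E refl refl refl h =
  ⊥-elim (S≢E (sym (+-cancelʳ-≡ S E S h)))
levels-exactly-one {S} {E} false false true  S≢E refl refl refl h =
  ⊥-elim (S≢E (+-cancelˡ-≡ E S E h))
levels-exactly-one {S} {E} false true  false S≢E refl refl refl h =
  ⊥-elim (S≢E (+-cancelʳ-≡ S S E h))
levels-exactly-one {S} {E} true  false false S≢E refl refl refl h =
  ⊥-elim (S≢E (+-cancelˡ-≡ S S E h))
levels-exactly-one {S} {E} false false false S≢E refl refl refl h =
  ⊥-elim (S≢E (double-injective h))
  where
  double-injective : ∀ {m n} → m + m ≡ n + n → m ≡ n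
  double-injective {m} {n} h with <-cmp m n
  ... | tri< m<n _ _ = ⊥-elim (<⇒≢ (+-mono-< m<n m<n) h)
  ... | tri≈ _ m≡n _ = m≡n
  ... | tri> _ _ n<m = ⊥-elim (>⇒≢ (+-mono-< n<m n<m) h)

-- Part 1: a region whose k-events all carry a border signature K
-- determines a one-in-three model, namely the unbalanced variables.

module Extraction (b : ℕ) {m : ℕ} (φ : Instance m) (sig : Ev m → ℕ × ℕ)
                  {K : ℕ × ℕ} (border : Border b K) (allK : AllK sig K) where
  open Walks b sig
  open Border border

  entry≤b : entry ≤ b
  entry≤b = subst (entry ≤_) complementary (m≤m+n entry exit)

  exit-unique : ∀ {X} → X + entry ≡ b → X ≡ exit
  exit-unique {X} h = +-cancelʳ-≡ entry X exit (trans h (sym (trans (+-comm exit entry) complementary)))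

  entry-unique : ∀ {X} → exit + X ≡ b → X ≡ entry
  entry-unique {X} h = +-cancelˡ-≡ exit X entry (trans h (sym (trans (+-comm exit entry) complementary)))

  k-enters : ∀ {κ s s'} → sig κ ≡ K → s ≤ b → TypeStep b s (sig κ) s' → s' ≡ entry
  k-enters eq s≤b st = enters s≤b (subst (λ ev → TypeStep b _ ev _) eq st)

  k-leaves : ∀ {κ s s'} → sig κ ≡ K → s ≤ b → TypeStep b s (sig κ) s' → s ≡ exit
  k-leaves eq s≤b st = leaves s≤b (subst (λ ev → TypeStep b _ ev _) eq st)

  run-from-entry : ∀ {X s B} → s ≡ entry → Walk s (replicate b X) B →
    B ≡ (if balanced X then entry else exit)
  run-from-entry {X} refl W with balanced X in eq
  ... | true  = digit-balanced {b} (walk-repeat b W) (balanced-true eq)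
  ... | false = exit-unique (digit-unbalanced {b} (walk-bounded entry≤b W) entry≤b
                                             (walk-repeat b W) (balanced-false eq))

  run-to-exit : ∀ {Y C s} → C ≤ b → Walk C (replicate b Y) s → s ≡ exit →
    C ≡ (if balanced Y then exit else entry)
  run-to-exit {Y} C≤b W refl with balanced Y in eq
  ... | true  = sym (digit-balanced {b} (walk-repeat b W) (balanced-true eq))
  ... | false = entry-unique (digit-unbalanced {b} (walk-bounded C≤b W) C≤b
                                               (walk-repeat b W) (balanced-false eq))

  trace₀ : ∀ {κ X ξ Y κ' s s'} → s ≤ b → sig κ ≡ K → sig κ' ≡ K →
    Walk s (κ ∷ replicate b X ++ ξ ∷ replicate b Y ++ κ' ∷ []) s' →
    Σ ℕ λ B → Σ ℕ λ C → B ≡ (if balanced X then entry else exit) ×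
      C ≡ (if balanced Y then exit else entry) × C + proj₁ (sig ξ) ≡ B + proj₂ (sig ξ)
  trace₀ {X = X} s≤b κK κ'K (κs ∷ W) with walk-split (replicate b X) W
  ... | B , WX , ξs ∷ W' with walk-split (replicate b _) W'
  ... | _ , WY , κs' ∷ [] =
    B , _ , run-from-entry (k-enters κK s≤b κs) WX ,
    run-to-exit (step-bounded ξs) WY (k-leaves κ'K (walk-bounded (step-bounded ξs) WY) κs') ,
    step-conserves ξs

  trace₁ : ∀ {κ X π κ' s s'} → s ≤ b → sig κ ≡ K → sig κ' ≡ K →
    Walk s (κ ∷ replicate b X ++ π ∷ κ' ∷ []) s' →
    Σ ℕ λ B' → B' ≡ (if balanced X then entry else exit) ×
      exit + proj₁ (sig π) ≡ B' + proj₂ (sig π)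
  trace₁ {X = X} s≤b κK κ'K (κs ∷ W) with walk-split (replicate b X) W
  ... | B' , WX , πs ∷ κs' ∷ [] =
    B' , run-from-entry (k-enters κK s≤b κs) WX ,
    subst (λ s₁ → s₁ + _ ≡ _) (k-leaves κ'K (step-bounded πs) κs') (step-conserves πs)

  trace₂ : ∀ {κ ξ π κ' s s'} → s ≤ b → sig κ ≡ K → sig κ' ≡ K →
    Walk s (κ ∷ ξ ∷ π ∷ κ' ∷ []) s' →
    Σ ℕ λ C'' → C'' + proj₁ (sig ξ) ≡ entry + proj₂ (sig ξ) ×
      exit + proj₁ (sig π) ≡ C'' + proj₂ (sig π)
  trace₂ {ξ = ξ} {π} s≤b κK κ'K (κs ∷ _∷_ {s₁ = C''} ξs (πs ∷ κs' ∷ [])) =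
    C'' , subst (λ s₁ → C'' + proj₁ (sig ξ) ≡ s₁ + proj₂ (sig ξ)) (k-enters κK s≤b κs) (step-conserves ξs) ,
    subst (λ s₁ → s₁ + proj₁ (sig π) ≡ C'' + proj₂ (sig π)) (k-leaves κ'K (step-bounded πs) κs') (step-conserves πs)

  module _ {t : Kind} {sup : (i : Fin m) (c : Fin 3) → State (Tcomp b φ i c) → ℕ}
           (region : IsRegionT t b φ sup sig) where

    component-walk : ∀ i c →
      Walk (sup i c fzero) (word b φ i c) (sup i c (fromℕ (length (word b φ i c))))
    component-walk i c = steps→walk (word b φ i c) (sup i c) (proj₂ (proj₂ (region i c)))

    start-bounded : ∀ i c → sup i c fzero ≤ b
    start-bounded i c = proj₁ (region i c) fzero

    unbalanced-variable : Fin m → Bool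
    unbalanced-variable v = not (balanced (var v))

    -- T_{i,1} and T_{i,2} end with the same p_i-step into exit, so they
    -- reach it from equal states B' ≡ C''; comparing the x_i-steps of
    -- T_{i,0} and T_{i,2} then gives C + entry ≡ B + B'.
    clause-exactly-one : ∀ i → ExactlyOne (unbalanced-variable (clause φ i j₀))
      (unbalanced-variable (clause φ i j₁)) (unbalanced-variable (clause φ i j₂))
    clause-exactly-one i
      with trace₀ (start-bounded i j₀) (allK i _) (allK i _) (component-walk i j₀)
         | trace₁ (start-bounded i j₁) (allK i _) (allK i _) (component-walk i j₁)
         | trace₂ (start-bounded i j₂) (allK i _) (allK i _) (component-walk i j₂)
    ... | B , C , B≡ , C≡ , ξ₀ | B' , B'≡ , π₁ | C'' , ξ₂ , π₂ =
      levels-exactly-one _ _ _ entry≢exit B≡ B'≡ C≡ (conserve-difference {C} {B} {B'} {entry} ξ₀ ξ₁)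
      where
      B'≡C'' : B' ≡ C''
      B'≡C'' = +-cancelʳ-≡ _ B' C'' (trans (sym π₁) π₂)
      ξ₁ : B' + proj₁ (sig (x i)) ≡ entry + proj₂ (sig (x i))
      ξ₁ = subst (λ s₁ → s₁ + _ ≡ _) (sym B'≡C'') ξ₂

    model : HasModel φ
    model = unbalanced-variable ,
      λ i → exactly-one⇒count (λ j → unbalanced-variable (clause φ i j)) (clause-exactly-one i)

-- X_v consumes one token iff v ∈ M; x_i empties the full state iff
-- X_{i,1} ∈ M, and p_i empties whatever is left otherwise.

module Construction (b : ℕ) (1≤b : 1 ≤ b) {m : ℕ} (φ : Instance m) (M : Fin m → Bool) where

  level : Bool → ℕ
  level β = if β then b else 0

  bit : Bool → ℕ
  bit β = if β then 1 else 0

  sig : Ev m → ℕ × ℕ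
  sig (var v) = bit (M v) , 0
  sig (k _ _) = 0 , b
  sig (x i)   = level (M (clause φ i j₁)) , 0
  sig (p i)   = level (not (M (clause φ i j₁))) , 0

  open Walks b sig

  level≤b : ∀ β → level β ≤ b
  level≤b true  = ≤-refl
  level≤b false = z≤n

  bit≤b : ∀ β → bit β ≤ b
  bit≤b true  = 1≤b
  bit≤b false = z≤n

  consuming-event : ∀ t {a} → a ≤ b → EventOf t b (a , 0)
  consuming-event τ0 a≤b = a≤b , z≤n
  consuming-event τ1 a≤b = a≤b , z≤n , inj₂ refl

  sig-event : ∀ t e → EventOf t b (sig e)
  sig-event t  (var v) = consuming-event t (bit≤b (M v))
  sig-event τ0 (k _ _) = z≤n , ≤-refl
  sig-event τ1 (k _ _) = z≤n , ≤-refl , inj₁ refl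
  sig-event t  (x i)   = consuming-event t (level≤b _)
  sig-event t  (p i)   = consuming-event t (level≤b _)

  from-top : ∀ v → Walk b (replicate b (var v)) (level (not (M v)))
  from-top v with M v in eq
  ... | true  = countdown b (cong (λ β → bit β , 0) eq) ≤-refl
  ... | false = idle b (cong (λ β → bit β , 0) eq) ≤-refl

  to-bottom : ∀ v → Walk (level (M v)) (replicate b (var v)) 0
  to-bottom v with M v in eq
  ... | true  = countdown b (cong (λ β → bit β , 0) eq) ≤-refl
  ... | false = idle b (cong (λ β → bit β , 0) eq) z≤n

  top-step : ∀ β → TypeStep b b (level β , 0) (level (not β))
  top-step true  = emptying-step ≤-refl
  top-step false = consuming-step z≤n ≤-refl

  -- x_i in T_{i,0}: the one-in-three condition makes the levels match.
  middle-step : ∀ {β₀ β₁ β₂} → ExactlyOne β₀ β₁ β₂ →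
    TypeStep b (level (not β₀)) (level β₁ , 0) (level β₂)
  middle-step first  = consuming-step z≤n z≤n
  middle-step second = emptying-step ≤-refl
  middle-step third  = consuming-step z≤n ≤-refl

  component-walk : ∀ i → ExactlyOne (M (clause φ i j₀)) (M (clause φ i j₁)) (M (clause φ i j₂)) →
    ∀ c → Walk 0 (word b φ i c) b
  component-walk i one fzero =
    filling-step ∷ walk-++ (from-top (clause φ i j₀))
      (middle-step one ∷ walk-++ (to-bottom (clause φ i j₂)) (filling-step ∷ []))
  component-walk i one (fsuc fzero) =
    filling-step ∷ walk-++ (from-top (clause φ i j₁))
      (emptying-step (level≤b _) ∷ filling-step ∷ [])
  component-walk i one (fsuc (fsuc fzero)) =
    filling-step ∷ top-step (M (clause φ i j₁)) ∷ emptying-step (level≤b _) ∷ filling-step ∷ []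

  region : (t : Kind) → IsModel φ M →
    Σ ((i : Fin m) (c : Fin 3) → State (Tcomp b φ i c) → ℕ) λ sup →
    IsRegionT t b φ sup sig
  region t model = (λ i c → walk-states (walk i c)) ,
    λ i c → states-bounded z≤n (walk i c) , sig-event t , walk-steps (walk i c)
    where
    walk : ∀ i c → Walk 0 (word b φ i c) b
    walk i = component-walk i (count⇒exactly-one (λ j → M (clause φ i j)) (model i))

lemma4 : (b : ℕ) → 1 ≤ b → (t : Kind) → (m : ℕ) → (φ : Instance m) →
    ((sup : (i : Fin m) (c : Fin 3) → State (Tcomp b φ i c) → ℕ) →
     (sig : Ev m → ℕ × ℕ) →
     IsRegionT t b φ sup sig → (AllK sig (0 , b) ⊎ AllK sig (b , 0)) →
     HasModel φ)
    ×
    (HasModel φ →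
     Σ ((i : Fin m) (c : Fin 3) → State (Tcomp b φ i c) → ℕ) λ sup →
     Σ (Ev m → ℕ × ℕ) λ sig →
     IsRegionT t b φ sup sig × AllK sig (0 , b))
lemma4 b 1≤b t m φ = extract , construct
  where
  extract : (sup : (i : Fin m) (c : Fin 3) → State (Tcomp b φ i c) → ℕ) →
    (sig : Ev m → ℕ × ℕ) → IsRegionT t b φ sup sig →
    AllK sig (0 , b) ⊎ AllK sig (b , 0) → HasModel φ
  extract sup sig region (inj₁ allK) = Extraction.model b φ sig (filling-border 1≤b) allK region
  extract sup sig region (inj₂ allK) = Extraction.model b φ sig (draining-border 1≤b) allK region

  construct : HasModel φ →
    Σ ((i : Fin m) (c : Fin 3) → State (Tcomp b φ i c) → ℕ) λ sup →
    Σ (Ev m → ℕ × ℕ) λ sig → IsRegionT t b φ sup sig × AllK sig (0 , b)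
  construct (M , model) with Construction.region b 1≤b φ M t model
  ... | sup , region = sup , Construction.sig b 1≤b φ M , region , λ _ _ → refl
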